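{- Let $I$ be a perfect matching of $K_{102}$. Then the edge set of $K_{102}-I$ can be decomposed into $5$-star factors.
   Context: A $5$-star is a copy of $K_{1,5}$. A $5$-star factor of a graph $H$ is a spanning subgraph of $H$ each of whose components is a $5$-star; a decomposition into $5$-star factors is a collection of such factors whose edge sets partition the edge set of $H$. -}

module Defs where

open import Data.Nat using (ℕ)
open import Data.Fin using (Fin; zero; suc)
open import Data.Bool using (Bool; true; false)
open import Data.Product using (Σ; _×_; _,_)
open import Data.Sum using (_⊎_)
open import Relation.Binary.PropositionalEquality using (_≡_; _≢_)
open import Function.Bundles using (_↔_; _⇔_; Inverse)

record Graph (n : ℕ) : Set where
  field
    adj   : Fin n → Fin n → Bool
    sym   : ∀ u v → adj u v ≡ adj v u
    irrefl : ∀ u → adj u u ≡ false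
open Graph public

_⊆ᴳ_ : ∀ {n} → Graph n → Graph n → Set
F ⊆ᴳ H = ∀ u v → adj F u v ≡ true → adj H u v ≡ true

∃!Fin : ∀ {k} → (Fin k → Set) → Set
∃!Fin {k} P = Σ (Fin k) λ j → P j × (∀ j′ → P j′ → j′ ≡ j)

IsPerfectMatching : ∀ {n} → Graph n → Set
IsPerfectMatching {n} I = ∀ u → ∃!Fin (λ v → adj I u v ≡ true)

KminusI : ∀ {n} → Graph n → Fin n → Fin n → Set
KminusI I u v = u ≢ v × adj I u v ≡ false

-- Concretely: the
-- vertex set is partitioned into k blocks of 6 vertices via a bijection
-- φ : Fin k × Fin 6 ↔ Fin n, where φ (i , 0) is the centre of star i and
-- φ (i , 1..5) are its leaves, and the edges of F are exactly the
-- centre–leaf pairs within each block.  (So each block is a component of F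
-- isomorphic to K_{1,5}, and these are all the components.)
record IsFiveStarFactor {n} (H : Fin n → Fin n → Set) (F : Graph n) : Set where
  field
    sub    : ∀ u v → adj F u v ≡ true → H u v
    k      : ℕ
    φ      : (Fin k × Fin 6) ↔ Fin n
    edges  : ∀ i a i′ b →
             (adj F (Inverse.to φ (i , a)) (Inverse.to φ (i′ , b)) ≡ true)
             ⇔ (i ≡ i′ × (a ≡ zero ⊎ b ≡ zero) × a ≢ b)

FiveStarFactorDecomposable : ∀ {n} → (Fin n → Fin n → Set) → Set
FiveStarFactorDecomposable {n} H =
  Σ ℕ λ t → Σ (Fin t → Graph n) λ F →
    (∀ j → IsFiveStarFactor H (F j)) ×
    (∀ u v → H u v → ∃!Fin (λ j → adj (F j) u v ≡ true))

module Submission where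

-- Identify the vertices of K₁₀₂ with ℤ₅₁ × ℤ₂ so that the perfect matching pairs (x , 0) with
-- (x , 1). Translation by ℤ₅₁ splits the 5100 remaining edges into 100 orbits of size 51. A base
-- 5-star factor whose 85 edges lie in distinct orbits yields 51 factors by translation. Three
-- more stars, each meeting every class of ℤ₃ × ℤ₂ once, cover the other 15 orbits: for each
-- t ∈ ℤ₃ the translates of such a star by 3ℤ₅₁ + t form a factor. Any other perfect matching is
-- carried to this one by a permutation of the vertices, built by fixing one pair at a time with a
-- transposition, and relabelling transports the 60 factors.

open import Defs hiding (sym)
open import Algebra.Definitions using (Involutive)
open import Data.Bool using (Bool; true; false)
open import Data.Bool.Properties using (¬-not)
open import Data.Fin using (Fin; zero; suc; toℕ; combine; remQuot; splitAt; _↑ˡ_; _↑ʳ_; fromℕ<; opposite)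
open import Data.Fin.Permutation using (Permutation′; id; _⟨$⟩ʳ_; _⟨$⟩ˡ_; inverseˡ; inverseʳ; transpose; _∘ₚ_)
import Data.Fin.Permutation.Components as PC
open import Data.Fin.Properties
  using (_≟_; all?; toℕ-fromℕ<; toℕ-injective; toℕ<n; combine-injective; combine-remQuot)
open import Data.Maybe using (Maybe; just; nothing; _<∣>_)
import Data.Maybe.Properties as Maybe
open import Data.Maybe.Relation.Unary.Any using (Any; just)
import Data.Maybe.Relation.Unary.Any as Any
open import Data.Nat using (ℕ; zero; suc; _+_; _*_; _∸_; _/_; _%_; _<_; _≤_)
open import Data.Nat.DivMod using (_mod_)
open import Data.Nat.Properties using (≤-refl; <⇒≤; m<1+n⇒m<n∨m≡n; <-irrefl)
open import Data.Product using (Σ; _×_; _,_; proj₁; proj₂; uncurry)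
open import Data.Product.Properties using () renaming (≡-dec to ×-≡-dec)
open import Data.Sum using (_⊎_; inj₁; inj₂; [_,_]′)
import Data.Sum as Sum
open import Data.Vec using (Vec; []; _∷_; lookup)
open import Function using (_∘_)
open import Function.Bundles using (_↔_; _⇔_; Inverse; Equivalence; mk↔ₛ′; mk⇔)
open import Function.Construct.Composition using (_↔-∘_; _⇔-∘_)
open import Relation.Nullary using (¬_; Dec; does; yes; no; ¬?; _×-dec_; _⊎-dec_; _→-dec_; contradiction)
open import Relation.Nullary.Decidable using (dec-true; dec-false; does-⇔)
open import Relation.Binary.PropositionalEquality
  using (_≡_; _≢_; refl; sym; trans; cong; subst; subst₂; module ≡-Reasoning)

witness : ∀ {A : Set} (a? : Dec A) → does a? ≡ true → A
witness (yes a) _ = a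

Stars : ℕ → Set
Stars k = Fin k × Fin 6

IsStarEdge : ∀ {k} → Stars k → Stars k → Set
IsStarEdge (i , a) (i′ , b) = i ≡ i′ × (a ≡ zero ⊎ b ≡ zero) × a ≢ b

isStarEdge? : ∀ {k} (s t : Stars k) → Dec (IsStarEdge s t)
isStarEdge? (i , a) (i′ , b) = i ≟ i′ ×-dec (a ≟ zero ⊎-dec b ≟ zero) ×-dec ¬? (a ≟ b)

IsStarEdge-sym : ∀ {k} {s t : Stars k} → IsStarEdge s t → IsStarEdge t s
IsStarEdge-sym (refl , centre , a≢b) = refl , Sum.swap centre , a≢b ∘ sym

IsStarEdge-irrefl : ∀ {k} {s : Stars k} → ¬ IsStarEdge s s
IsStarEdge-irrefl (_ , _ , a≢a) = a≢a refl

IsStarEdge-elim : ∀ {k} (P : Stars k → Stars k → Set) →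
                  (∀ i b → b ≢ zero → P (i , zero) (i , b) × P (i , b) (i , zero)) →
                  ∀ {s t} → IsStarEdge s t → P s t
IsStarEdge-elim P centre-leaf (refl , inj₁ refl , 0≢b) = proj₁ (centre-leaf _ _ (0≢b ∘ sym))
IsStarEdge-elim P centre-leaf (refl , inj₂ refl , a≢0) = proj₂ (centre-leaf _ _ a≢0)

starAdj : ∀ {k} → Stars k → Stars k → Bool
starAdj s t = does (isStarEdge? s t)

starAdj-sym : ∀ {k} (s t : Stars k) → starAdj s t ≡ starAdj t s
starAdj-sym s t = does-⇔ (mk⇔ IsStarEdge-sym IsStarEdge-sym) (isStarEdge? s t) (isStarEdge? t s)

starAdj-irrefl : ∀ {k} (s : Stars k) → starAdj s s ≡ false
starAdj-irrefl s = dec-false (isStarEdge? s s) IsStarEdge-irrefl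

starAdj⇔IsStarEdge : ∀ {k} {s t : Stars k} → starAdj s t ≡ true ⇔ IsStarEdge s t
starAdj⇔IsStarEdge {s = s} {t} = mk⇔ (witness (isStarEdge? s t)) (dec-true (isStarEdge? s t))

module _ {n k : ℕ} (φ : Stars k ↔ Fin n) where
  open Inverse φ

  starFactor : Graph n
  starFactor = record
    { adj    = λ u v → starAdj (from u) (from v)
    ; sym    = λ u v → starAdj-sym (from u) (from v)
    ; irrefl = λ u → starAdj-irrefl (from u)
    }

  starFactor-isFiveStarFactor : {H : Fin n → Fin n → Set} →
                                (∀ {s t} → IsStarEdge s t → H (to s) (to t)) →
                                IsFiveStarFactor H starFactor
  starFactor-isFiveStarFactor {H} starEdge⇒H = record
    { sub   = λ u v uv → subst₂ H (strictlyInverseˡ u) (strictlyInverseˡ v)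
                                  (starEdge⇒H (Equivalence.to starAdj⇔IsStarEdge uv))
    ; k     = k
    ; φ     = φ
    ; edges = λ i a i′ b → subst₂ (λ s t → starAdj s t ≡ true ⇔ IsStarEdge (i , a) (i′ , b))
                                  (sym (strictlyInverseʳ (i , a))) (sym (strictlyInverseʳ (i′ , b)))
                                  starAdj⇔IsStarEdge
    }

-- factorOf names the factor containing each edge; it reduces the uniqueness of that factor to a
-- property of single pairs of vertices.
record StarDecomposition {n} (H : Fin n → Fin n → Set) (t k : ℕ) : Set where
  field
    layout   : Fin t → Stars k ↔ Fin n
    factorOf : Fin n → Fin n → Maybe (Fin t)

  place : Fin t → Stars k → Fin n
  place j = Inverse.to (layout j)

  position : Fin t → Fin n → Stars k
  position j = Inverse.from (layout j)

  field
    factorOf-starEdge : ∀ j {s s′} → IsStarEdge s s′ → factorOf (place j s) (place j s′) ≡ just j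
    starEdge⇒H        : ∀ j {s s′} → IsStarEdge s s′ → H (place j s) (place j s′)
    H⇒starEdge        : ∀ {u v} → H u v → Any (λ j → IsStarEdge (position j u) (position j v)) (factorOf u v)

module _ {n} {H : Fin n → Fin n → Set} {t k} (D : StarDecomposition H t k) where
  open StarDecomposition D

  factor : Fin t → Graph n
  factor j = starFactor (layout j)

  factor-adj⇒factorOf : ∀ j {u v} → adj (factor j) u v ≡ true → factorOf u v ≡ just j
  factor-adj⇒factorOf j {u} {v} uv =
    subst₂ (λ x y → factorOf x y ≡ just j)
           (Inverse.strictlyInverseˡ (layout j) u) (Inverse.strictlyInverseˡ (layout j) v)
           (factorOf-starEdge j (Equivalence.to starAdj⇔IsStarEdge uv))

  unique-factor : ∀ {u v} → H u v → ∃!Fin (λ j → adj (factor j) u v ≡ true)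
  unique-factor {u} {v} uv with factorOf u v in eq | H⇒starEdge uv
  ... | just j | just starEdge =
    j , Equivalence.from starAdj⇔IsStarEdge starEdge ,
    λ j′ uv∈j′ → Maybe.just-injective (trans (sym (factor-adj⇒factorOf j′ uv∈j′)) eq)

  StarDecomposition⇒decomposable : FiveStarFactorDecomposable H
  StarDecomposition⇒decomposable =
    t , factor , (λ j → starFactor-isFiveStarFactor (layout j) (starEdge⇒H j)) , λ _ _ → unique-factor

relabel : ∀ {n} {H H₀ : Fin n → Fin n → Set} {t k} (σ : Permutation′ n) →
          (∀ {u v} → H u v ⇔ H₀ (σ ⟨$⟩ˡ u) (σ ⟨$⟩ˡ v)) →
          StarDecomposition H₀ t k → StarDecomposition H t k
relabel {H₀ = H₀} σ H⇔H₀ D = record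
  { layout            = λ j → σ ↔-∘ layout j
  ; factorOf          = λ u v → factorOf (σ ⟨$⟩ˡ u) (σ ⟨$⟩ˡ v)
  ; factorOf-starEdge = λ j e → subst₂ (λ x y → factorOf x y ≡ just j)
                                       (sym (inverseˡ σ)) (sym (inverseˡ σ)) (factorOf-starEdge j e)
  ; starEdge⇒H        = λ j e → Equivalence.from H⇔H₀
                                  (subst₂ H₀ (sym (inverseˡ σ)) (sym (inverseˡ σ)) (starEdge⇒H j e))
  ; H⇒starEdge        = λ uv → H⇒starEdge (Equivalence.to H⇔H₀ uv)
  }
  where open StarDecomposition D

KminusPairing : ∀ {n} → (Fin n → Fin n) → Fin n → Fin n → Set
KminusPairing p u v = u ≢ v × v ≢ p u

kminusPairing? : ∀ {n} (p : Fin n → Fin n) u v → Dec (KminusPairing p u v)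
kminusPairing? p u v = ¬? (u ≟ v) ×-dec ¬? (v ≟ p u)

KminusPairing-conjugate : ∀ {n} {p q : Fin n → Fin n} (σ : Permutation′ n) →
                          (∀ x → p (σ ⟨$⟩ʳ x) ≡ σ ⟨$⟩ʳ q x) →
                          ∀ {u v} → KminusPairing p u v ⇔ KminusPairing q (σ ⟨$⟩ˡ u) (σ ⟨$⟩ˡ v)
KminusPairing-conjugate {p = p} {q} σ p∘σ≡σ∘q {u} {v} = mk⇔
  (λ (u≢v , v≢pu) → (λ e → u≢v (σ⁻¹-injective e)) ,
                    (λ e → v≢pu (trans (sym (inverseʳ σ)) (trans (cong (σ ⟨$⟩ʳ_) e) (sym (p-via-q u))))))
  (λ (u′≢v′ , v′≢qu′) → (λ e → u′≢v′ (cong (σ ⟨$⟩ˡ_) e)) ,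
                        (λ e → v′≢qu′ (trans (cong (σ ⟨$⟩ˡ_) (trans e (p-via-q u))) (inverseˡ σ))))
  where
  σ⁻¹-injective : ∀ {x y} → σ ⟨$⟩ˡ x ≡ σ ⟨$⟩ˡ y → x ≡ y
  σ⁻¹-injective e = trans (sym (inverseʳ σ)) (trans (cong (σ ⟨$⟩ʳ_) e) (inverseʳ σ))
  p-via-q : ∀ x → p x ≡ σ ⟨$⟩ʳ q (σ ⟨$⟩ˡ x)
  p-via-q x = trans (cong p (sym (inverseʳ σ))) (p∘σ≡σ∘q (σ ⟨$⟩ˡ x))

module PerfectMatching {n} (I : Graph n) (perfect : IsPerfectMatching I) where

  partner : Fin n → Fin n
  partner u = proj₁ (perfect u)

  partner-adj : ∀ u → adj I u (partner u) ≡ true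
  partner-adj u = proj₁ (proj₂ (perfect u))

  partner-unique : ∀ {u v} → adj I u v ≡ true → v ≡ partner u
  partner-unique {u} {v} = proj₂ (proj₂ (perfect u)) v

  partner-involutive : Involutive _≡_ partner
  partner-involutive u = sym (partner-unique (trans (Graph.sym I (partner u) u) (partner-adj u)))

  partner-irrefl : ∀ u → partner u ≢ u
  partner-irrefl u e = contradiction (trans (sym (partner-adj u)) (trans (cong (adj I u) e) (irrefl I u))) λ ()

  KminusI⇔KminusPairing : ∀ {u v} → KminusI I u v ⇔ KminusPairing partner u v
  KminusI⇔KminusPairing {u} = mk⇔
    (λ (u≢v , uv∉I) → u≢v , λ { refl → contradiction (trans (sym (partner-adj u)) uv∉I) λ () })
    (λ (u≢v , v≢pu) → u≢v , ¬-not (v≢pu ∘ partner-unique))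

pairSwap : ∀ {m} → Fin (m * 2) → Fin (m * 2)
pairSwap {suc m} zero          = suc zero
pairSwap {suc m} (suc zero)    = zero
pairSwap {suc m} (suc (suc x)) = suc (suc (pairSwap {m} x))

pair : ∀ {m} → Fin m → Fin 2 → Fin (m * 2)
pair = combine

pairSwap-pair : ∀ {m} (c : Fin m) l → pairSwap {m} (pair c l) ≡ pair c (opposite l)
pairSwap-pair zero    zero       = refl
pairSwap-pair zero    (suc zero) = refl
pairSwap-pair (suc c) l          = cong (λ (x : Fin _) → suc (suc x)) (pairSwap-pair c l)

combine-≢ˡ : ∀ {m n} {c c′ : Fin m} (l l′ : Fin n) → c ≢ c′ → combine c l ≢ combine c′ l′
combine-≢ˡ l l′ c≢c′ = c≢c′ ∘ proj₁ ∘ combine-injective _ l _ l′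

combine-≢ʳ : ∀ {m n} (c c′ : Fin m) {l l′ : Fin n} → l ≢ l′ → combine c l ≢ combine c′ l′
combine-≢ʳ c c′ l≢l′ = l≢l′ ∘ proj₂ ∘ combine-injective c _ c′ _

transpose-matchʳ : ∀ {n} (i j : Fin n) → PC.transpose i j j ≡ i
transpose-matchʳ i j with j ≟ i
... | yes j≡i = j≡i
... | no _ rewrite dec-true (j ≟ j) refl = refl

transpose-noMatch : ∀ {n} {i j k : Fin n} → k ≢ i → k ≢ j → PC.transpose i j k ≡ k
transpose-noMatch {i = i} {j} {k} k≢i k≢j rewrite dec-false (k ≟ i) k≢i | dec-false (k ≟ j) k≢j = refl

module _ {m} (p : Fin (m * 2) → Fin (m * 2)) (p-involutive : Involutive _≡_ p) (p-irrefl : ∀ x → p x ≢ x) where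

  conj : Permutation′ (m * 2) → Fin (m * 2) → Fin (m * 2)
  conj σ x = σ ⟨$⟩ˡ p (σ ⟨$⟩ʳ x)

  conj-involutive : ∀ σ → Involutive _≡_ (conj σ)
  conj-involutive σ x = begin
    σ ⟨$⟩ˡ p (σ ⟨$⟩ʳ (σ ⟨$⟩ˡ p (σ ⟨$⟩ʳ x))) ≡⟨ cong (λ y → σ ⟨$⟩ˡ p y) (inverseʳ σ) ⟩
    σ ⟨$⟩ˡ p (p (σ ⟨$⟩ʳ x))                 ≡⟨ cong (σ ⟨$⟩ˡ_) (p-involutive _) ⟩
    σ ⟨$⟩ˡ (σ ⟨$⟩ʳ x)                       ≡⟨ inverseˡ σ ⟩
    x                                       ∎
    where open ≡-Reasoning

  conj-sym : ∀ σ {x y} → conj σ x ≡ y → conj σ y ≡ x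
  conj-sym σ {x} x↦y = trans (cong (conj σ) (sym x↦y)) (conj-involutive σ x)

  conj-irrefl : ∀ σ x → conj σ x ≢ x
  conj-irrefl σ x e = p-irrefl (σ ⟨$⟩ʳ x) (trans (sym (inverseʳ σ)) (cong (σ ⟨$⟩ʳ_) e))

  Matched : ℕ → Permutation′ (m * 2) → Set
  Matched i σ = ∀ (c : Fin m) → toℕ c < i → conj σ (pair c zero) ≡ pair c (suc zero)

  -- Composing σ with the transposition of q a and b, where q = σ⁻¹ p σ, makes a and b partners
  -- and fixes the pairs matched so far, because q pairs them among themselves.
  match-next : ∀ {i} (i<m : i < m) σ → Matched i σ → Σ (Permutation′ (m * 2)) (Matched (suc i))
  match-next {i} i<m σ matched = σ′ , matched′
    where
    q : Fin (m * 2) → Fin (m * 2)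
    q = conj σ
    c₀ : Fin m
    c₀ = fromℕ< i<m
    a b : Fin (m * 2)
    a = pair c₀ zero
    b = pair c₀ (suc zero)
    σ′ : Permutation′ (m * 2)
    σ′ = transpose (q a) b ∘ₚ σ

    0≢1 : zero ≢ suc zero
    0≢1 ()

    new-pair : conj σ′ a ≡ b
    new-pair = begin
      conj σ′ a                                         ≡⟨⟩
      PC.transpose b (q a) (q (PC.transpose (q a) b a)) ≡⟨ cong (PC.transpose b (q a) ∘ q) a-fixed ⟩
      PC.transpose b (q a) (q a)                        ≡⟨ transpose-matchʳ b (q a) ⟩
      b                                                 ∎
      where
      open ≡-Reasoning
      a-fixed : PC.transpose (q a) b a ≡ a
      a-fixed = transpose-noMatch (conj-irrefl σ a ∘ sym) (combine-≢ʳ c₀ c₀ 0≢1)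

    old-pair : ∀ c → toℕ c < i → conj σ′ (pair c zero) ≡ pair c (suc zero)
    old-pair c c<i = begin
      conj σ′ x                                         ≡⟨⟩
      PC.transpose b (q a) (q (PC.transpose (q a) b x)) ≡⟨ cong (PC.transpose b (q a) ∘ q) x-fixed ⟩
      PC.transpose b (q a) (q x)                        ≡⟨ cong (PC.transpose b (q a)) qx≡y ⟩
      PC.transpose b (q a) y                            ≡⟨ transpose-noMatch y≢b y≢qa ⟩
      y                                                 ∎
      where
      open ≡-Reasoning
      x y : Fin (m * 2)
      x = pair c zero
      y = pair c (suc zero)
      qx≡y : q x ≡ y
      qx≡y = matched c c<i
      c≢c₀ : c ≢ c₀
      c≢c₀ c≡c₀ = <-irrefl (trans (cong toℕ c≡c₀) (toℕ-fromℕ< i<m)) c<i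
      x-fixed : PC.transpose (q a) b x ≡ x
      x-fixed = transpose-noMatch
        (λ x≡qa → combine-≢ʳ c c₀ (0≢1 ∘ sym) (trans (sym qx≡y) (conj-sym σ (sym x≡qa))))
        (combine-≢ʳ c c₀ 0≢1)
      y≢b : y ≢ b
      y≢b = combine-≢ˡ {n = 2} (suc zero) (suc zero) c≢c₀
      y≢qa : y ≢ q a
      y≢qa y≡qa = combine-≢ˡ {n = 2} zero zero c≢c₀
        (trans (sym (conj-sym σ qx≡y)) (conj-sym σ (sym y≡qa)))

    matched′ : Matched (suc i) σ′
    matched′ c c≤i = [ old-pair c , (λ c≡i → subst (λ c → conj σ′ (pair c zero) ≡ pair c (suc zero))
                                                  (sym (toℕ-injective (trans c≡i (sym (toℕ-fromℕ< i<m)))))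
                                                  new-pair) ]′
                     (m<1+n⇒m<n∨m≡n c≤i)

  match-first : ∀ i → i ≤ m → Σ (Permutation′ (m * 2)) (Matched i)
  match-first zero    _   = id , λ _ ()
  match-first (suc i) i<m = let σ , matched = match-first i (<⇒≤ i<m) in match-next i<m σ matched

  conj≗pairSwap : ∀ σ → Matched m σ → ∀ x → conj σ x ≡ pairSwap {m} x
  conj≗pairSwap σ matched-all x =
    subst (λ x → conj σ x ≡ pairSwap {m} x) (combine-remQuot {m} 2 x) (on-pair (remQuot 2 x))
    where
    on-pair : (cl : Fin m × Fin 2) → conj σ (uncurry pair cl) ≡ pairSwap {m} (uncurry pair cl)
    on-pair (c , zero)     = trans (matched-all c (toℕ<n c)) (sym (pairSwap-pair c zero))
    on-pair (c , suc zero) = trans (conj-sym σ (matched-all c (toℕ<n c))) (sym (pairSwap-pair c (suc zero)))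

  -- Opaque, so that type checking never unfolds the m nested transpositions of σ, which blows up.
  opaque
    conjugate-to-pairSwap : Σ (Permutation′ (m * 2)) λ σ → ∀ x → p (σ ⟨$⟩ʳ x) ≡ σ ⟨$⟩ʳ pairSwap {m} x
    conjugate-to-pairSwap =
      let σ , matched-all = match-first m ≤-refl
      in σ , λ x → trans (sym (inverseʳ σ)) (cong (σ ⟨$⟩ʳ_) (conj≗pairSwap σ matched-all x))

-- The 60 factors of K₁₀₂ minus pairSwap {51}: for j ∈ ℤ₅₁ the base factor translated by j, and
-- for k, t ∈ ℤ₃ the translates of short star k by 3i + t, i ∈ ℤ₁₇. The vertex (x , l) ∈ ℤ₅₁ × ℤ₂
-- has code 2x + l, so pairSwap {51} pairs (x , 0) with (x , 1); rows list the centre of a star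
-- first. Computation runs on codes in ℕ, where arithmetic is builtin, and results are brought
-- into Fin with _mod_; the checks below verify every value used, so no range argument is needed.

data Orbit : Set where
  none   : Orbit
  cyclic : ℕ → Orbit
  short  : ℕ → Orbit

baseFactor : Vec (Vec ℕ 6) 17
baseFactor =
    (1 ∷ 15 ∷ 13 ∷ 33 ∷ 42 ∷ 96 ∷ [])
  ∷ (5 ∷ 25 ∷ 73 ∷ 101 ∷ 94 ∷ 41 ∷ [])
  ∷ (8 ∷ 67 ∷ 79 ∷ 27 ∷ 77 ∷ 84 ∷ [])
  ∷ (12 ∷ 45 ∷ 49 ∷ 3 ∷ 48 ∷ 24 ∷ [])
  ∷ (53 ∷ 35 ∷ 23 ∷ 26 ∷ 93 ∷ 78 ∷ [])
  ∷ (54 ∷ 68 ∷ 75 ∷ 19 ∷ 46 ∷ 16 ∷ [])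
  ∷ (60 ∷ 95 ∷ 31 ∷ 36 ∷ 50 ∷ 18 ∷ [])
  ∷ (63 ∷ 70 ∷ 59 ∷ 40 ∷ 39 ∷ 9 ∷ [])
  ∷ (64 ∷ 47 ∷ 58 ∷ 14 ∷ 20 ∷ 2 ∷ [])
  ∷ (69 ∷ 11 ∷ 82 ∷ 28 ∷ 22 ∷ 88 ∷ [])
  ∷ (71 ∷ 72 ∷ 98 ∷ 29 ∷ 56 ∷ 7 ∷ [])
  ∷ (74 ∷ 51 ∷ 76 ∷ 44 ∷ 52 ∷ 6 ∷ [])
  ∷ (80 ∷ 21 ∷ 17 ∷ 91 ∷ 10 ∷ 62 ∷ [])
  ∷ (83 ∷ 99 ∷ 66 ∷ 55 ∷ 81 ∷ 57 ∷ [])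
  ∷ (86 ∷ 4 ∷ 65 ∷ 90 ∷ 38 ∷ 0 ∷ [])
  ∷ (87 ∷ 30 ∷ 37 ∷ 32 ∷ 92 ∷ 34 ∷ [])
  ∷ (100 ∷ 89 ∷ 97 ∷ 61 ∷ 43 ∷ 85 ∷ [])
  ∷ []

-- Entry c is 6i + a where slot a of star i of the base factor has code c.
baseFactorInverse : Vec ℕ 102
baseFactorInverse =
    89 ∷ 0 ∷ 53 ∷ 21 ∷ 85 ∷ 6 ∷ 71 ∷ 65 ∷ 12 ∷ 47 ∷ 76 ∷ 55 ∷ 18 ∷ 2 ∷ 51 ∷ 1 ∷ 35
  ∷ 74 ∷ 41 ∷ 33 ∷ 52 ∷ 73 ∷ 58 ∷ 26 ∷ 23 ∷ 7 ∷ 27 ∷ 15 ∷ 57 ∷ 63 ∷ 91 ∷ 38 ∷ 93 ∷ 3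
  ∷ 95 ∷ 25 ∷ 39 ∷ 92 ∷ 88 ∷ 46 ∷ 45 ∷ 11 ∷ 4 ∷ 100 ∷ 69 ∷ 19 ∷ 34 ∷ 49 ∷ 22 ∷ 20 ∷ 40
  ∷ 67 ∷ 70 ∷ 24 ∷ 30 ∷ 81 ∷ 64 ∷ 83 ∷ 50 ∷ 44 ∷ 36 ∷ 99 ∷ 77 ∷ 42 ∷ 48 ∷ 86 ∷ 80 ∷ 13
  ∷ 31 ∷ 54 ∷ 43 ∷ 60 ∷ 61 ∷ 8 ∷ 66 ∷ 32 ∷ 68 ∷ 16 ∷ 29 ∷ 14 ∷ 72 ∷ 82 ∷ 56 ∷ 78 ∷ 17
  ∷ 101 ∷ 84 ∷ 90 ∷ 59 ∷ 97 ∷ 87 ∷ 75 ∷ 94 ∷ 28 ∷ 10 ∷ 37 ∷ 5 ∷ 98 ∷ 62 ∷ 79 ∷ 96 ∷ 9 ∷ []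

shortStars : Vec (Vec ℕ 6) 3
shortStars =
    (1 ∷ 81 ∷ 11 ∷ 54 ∷ 98 ∷ 94 ∷ [])
  ∷ (1 ∷ 57 ∷ 95 ∷ 72 ∷ 38 ∷ 100 ∷ [])
  ∷ (0 ∷ 56 ∷ 28 ∷ 25 ∷ 51 ∷ 29 ∷ [])
  ∷ []

-- Entry k, l, r is the slot of short star k whose vertex (x , l) has x ≡ r (mod 3).
shortSlot : Vec (Vec (Vec ℕ 3) 2) 3
shortSlot =
    ((3 ∷ 4 ∷ 5 ∷ []) ∷ (0 ∷ 1 ∷ 2 ∷ []) ∷ [])
  ∷ ((3 ∷ 4 ∷ 5 ∷ []) ∷ (0 ∷ 1 ∷ 2 ∷ []) ∷ [])
  ∷ ((0 ∷ 1 ∷ 2 ∷ []) ∷ (3 ∷ 4 ∷ 5 ∷ []) ∷ [])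
  ∷ []

-- Entry l, l′, d describes the orbit of the pairs (x , l) — (x + d , l′): it is met by the base
-- factor in the pair starting at (y , l) (cyclic y), or by short star k in a pair starting at its
-- centre (short k); none if the orbit is listed with its ends swapped, or is not an edge orbit.
orbitTable : Vec (Vec (Vec Orbit 51) 2) 2
orbitTable =
    ( (none ∷ (cyclic 37) ∷ (cyclic 43) ∷ none ∷ none ∷ none ∷ (cyclic 6) ∷ (cyclic 27)
      ∷ (cyclic 43) ∷ none ∷ (cyclic 43) ∷ none ∷ none ∷ none ∷ (short 2) ∷ none
      ∷ (cyclic 40) ∷ (cyclic 37) ∷ (cyclic 6) ∷ none ∷ (cyclic 32) ∷ none ∷ none ∷ none
      ∷ none ∷ none ∷ (cyclic 32) ∷ (cyclic 43) ∷ (short 2) ∷ (cyclic 32) ∷ (cyclic 30) ∷ none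
      ∷ (cyclic 27) ∷ none ∷ none ∷ none ∷ (cyclic 37) ∷ none ∷ (cyclic 4) ∷ (cyclic 30)
      ∷ (cyclic 37) ∷ none ∷ (cyclic 40) ∷ none ∷ none ∷ none ∷ (cyclic 30) ∷ (cyclic 27)
      ∷ (cyclic 32) ∷ none ∷ none ∷ [])
    ∷ (none ∷ none ∷ none ∷ none ∷ none ∷ (cyclic 40) ∷ none ∷ none
      ∷ none ∷ (cyclic 4) ∷ (cyclic 27) ∷ none ∷ (short 2) ∷ none ∷ (short 2) ∷ none
      ∷ (cyclic 6) ∷ (cyclic 30) ∷ (cyclic 6) ∷ (cyclic 40) ∷ none ∷ (cyclic 40) ∷ (cyclic 50) ∷ none
      ∷ none ∷ (short 2) ∷ none ∷ none ∷ none ∷ (cyclic 4) ∷ none ∷ (cyclic 50)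
      ∷ none ∷ (cyclic 27) ∷ (cyclic 4) ∷ (cyclic 4) ∷ (cyclic 30) ∷ none ∷ none ∷ (cyclic 37)
      ∷ (cyclic 43) ∷ none ∷ (cyclic 32) ∷ (cyclic 50) ∷ none ∷ (cyclic 50) ∷ (cyclic 6) ∷ none
      ∷ none ∷ (cyclic 50) ∷ none ∷ [])
    ∷ [])
  ∷ ( (none ∷ (cyclic 35) ∷ none ∷ (cyclic 43) ∷ (cyclic 31) ∷ none ∷ none ∷ (cyclic 34)
      ∷ none ∷ none ∷ (cyclic 34) ∷ none ∷ none ∷ (cyclic 26) ∷ (cyclic 35) ∷ none
      ∷ none ∷ none ∷ none ∷ (short 1) ∷ none ∷ (cyclic 0) ∷ none ∷ (cyclic 43)
      ∷ (cyclic 43) ∷ (cyclic 43) ∷ none ∷ (short 0) ∷ (cyclic 34) ∷ none ∷ none ∷ (cyclic 34)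
      ∷ none ∷ none ∷ none ∷ none ∷ (short 1) ∷ none ∷ (cyclic 26) ∷ none
      ∷ (cyclic 31) ∷ none ∷ none ∷ (cyclic 41) ∷ (cyclic 35) ∷ (cyclic 2) ∷ none ∷ (short 0)
      ∷ (cyclic 0) ∷ (short 0) ∷ (short 1) ∷ [])
    ∷ (none ∷ none ∷ none ∷ none ∷ none ∷ (short 0) ∷ (cyclic 0) ∷ (cyclic 0)
      ∷ (cyclic 41) ∷ none ∷ (cyclic 2) ∷ none ∷ none ∷ none ∷ none ∷ none
      ∷ (cyclic 0) ∷ none ∷ (cyclic 2) ∷ (cyclic 35) ∷ (cyclic 26) ∷ none ∷ (cyclic 34) ∷ none
      ∷ (cyclic 31) ∷ none ∷ (cyclic 43) ∷ none ∷ (short 1) ∷ none ∷ (cyclic 35) ∷ none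
      ∷ none ∷ none ∷ (cyclic 2) ∷ none ∷ (cyclic 26) ∷ (cyclic 41) ∷ (cyclic 41) ∷ (cyclic 31)
      ∷ (short 0) ∷ none ∷ (cyclic 26) ∷ none ∷ none ∷ none ∷ none ∷ (short 1)
      ∷ (cyclic 2) ∷ (cyclic 31) ∷ (cyclic 41) ∷ [])
    ∷ [])
  ∷ []

shift : ℕ → ℕ → ℕ
shift d c = 2 * ((c / 2 + d) % 51) + c % 2

cyclicPlace : Fin 51 → Stars 17 → ℕ
cyclicPlace j (i , a) = shift (toℕ j) (lookup (lookup baseFactor i) a)

cyclicPosition : Fin 51 → ℕ → ℕ
cyclicPosition j c = lookup baseFactorInverse (shift (51 ∸ toℕ j) c mod 102)

shortPlace : Fin 3 → Fin 3 → Stars 17 → ℕ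
shortPlace k t (i , a) = shift (3 * toℕ i + toℕ t) (lookup (lookup shortStars k) a)

shortPosition : Fin 3 → Fin 3 → ℕ → ℕ
shortPosition k t c =
  let c′ = shift (51 ∸ toℕ t) c
      a  = lookup (lookup (lookup shortSlot k) (c′ mod 2)) ((c′ / 2) mod 3)
      x₀ = lookup (lookup shortStars k) (a mod 6) / 2
  in 6 * (((c′ / 2 + 51 ∸ x₀) % 51) / 3) + a

standardPlace : Fin 60 → Stars 17 → Fin 102
standardPlace j s = [ cyclicPlace , uncurry shortPlace ∘ remQuot 3 ]′ (splitAt 51 j) s mod 102

standardPosition : Fin 60 → Fin 102 → Stars 17
standardPosition j v =
  let p = [ cyclicPosition , uncurry shortPosition ∘ remQuot 3 ]′ (splitAt 51 j) (toℕ v)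
  in (p / 6) mod 17 , (p % 6) mod 6

orbitFactor : ℕ → Orbit → Maybe (Fin 60)
orbitFactor x none       = nothing
orbitFactor x (cyclic y) = just (((x + 51 ∸ y) mod 51) ↑ˡ 9)
orbitFactor x (short k)  = just (51 ↑ʳ combine (k mod 3) (x mod 3))

orientedFactorOf : ℕ → ℕ → Maybe (Fin 60)
orientedFactorOf c d = orbitFactor (c / 2)
  (lookup (lookup (lookup orbitTable (c mod 2)) (d mod 2)) ((d / 2 + 51 ∸ c / 2) mod 51))

standardFactorOf : Fin 102 → Fin 102 → Maybe (Fin 60)
standardFactorOf u v = orientedFactorOf (toℕ u) (toℕ v) <∣> orientedFactorOf (toℕ v) (toℕ u)

Certified : Fin 60 → Fin 102 → Fin 102 → Set
Certified j u v = standardFactorOf u v ≡ just j × KminusPairing (pairSwap {51}) u v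

certified? : ∀ j u v → Dec (Certified j u v)
certified? j u v = Maybe.≡-dec _≟_ (standardFactorOf u v) (just j) ×-dec kminusPairing? (pairSwap {51}) u v

place-position : ∀ j v → standardPlace j (standardPosition j v) ≡ v
place-position = witness (all? λ j → all? λ v → standardPlace j (standardPosition j v) ≟ v) refl

position-place : ∀ j i a → standardPosition j (standardPlace j (i , a)) ≡ (i , a)
position-place = witness (all? λ j → all? λ i → all? λ a →
  ×-≡-dec _≟_ _≟_ (standardPosition j (standardPlace j (i , a))) (i , a)) refl

centreLeaf-certified : ∀ j i b → b ≢ zero →
                       let c = standardPlace j (i , zero); l = standardPlace j (i , b)
                       in Certified j c l × Certified j l c
centreLeaf-certified = witness (all? λ j → all? λ i → all? λ b → ¬? (b ≟ zero) →-dec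
  (λ c l → certified? j c l ×-dec certified? j l c) (standardPlace j (i , zero)) (standardPlace j (i , b))) refl

starEdge-certified : ∀ j {s s′} → IsStarEdge s s′ → Certified j (standardPlace j s) (standardPlace j s′)
starEdge-certified j =
  IsStarEdge-elim (λ s s′ → Certified j (standardPlace j s) (standardPlace j s′)) (centreLeaf-certified j)

edge-certified : ∀ u v → KminusPairing (pairSwap {51}) u v →
                 Any (λ j → IsStarEdge (standardPosition j u) (standardPosition j v)) (standardFactorOf u v)
edge-certified = witness (all? λ u → all? λ v → kminusPairing? (pairSwap {51}) u v →-dec
  Any.dec (λ j → isStarEdge? (standardPosition j u) (standardPosition j v)) (standardFactorOf u v)) refl

standardDecomposition : StarDecomposition (KminusPairing (pairSwap {51})) 60 17
standardDecomposition = record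
  { layout            = λ j → mk↔ₛ′ (standardPlace j) (standardPosition j)
                                    (place-position j) (uncurry (position-place j))
  ; factorOf          = standardFactorOf
  ; factorOf-starEdge = λ j → proj₁ ∘ starEdge-certified j
  ; starEdge⇒H        = λ j → proj₂ ∘ starEdge-certified j
  ; H⇒starEdge        = edge-certified _ _
  }

lemma6p2 : (I : Graph 102) → IsPerfectMatching I → FiveStarFactorDecomposable (KminusI I)
lemma6p2 I perfect = StarDecomposition⇒decomposable (relabel σ KminusI⇔standard standardDecomposition)
  where
  open PerfectMatching I perfect
  conjugation : Σ (Permutation′ 102) λ σ → ∀ x → partner (σ ⟨$⟩ʳ x) ≡ σ ⟨$⟩ʳ pairSwap {51} x
  conjugation = conjugate-to-pairSwap {51} partner partner-involutive partner-irrefl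
  σ : Permutation′ 102
  σ = proj₁ conjugation
  KminusI⇔standard : ∀ {u v} → KminusI I u v ⇔ KminusPairing (pairSwap {51}) (σ ⟨$⟩ˡ u) (σ ⟨$⟩ˡ v)
  KminusI⇔standard = KminusPairing-conjugate σ (proj₂ conjugation) ⇔-∘ KminusI⇔KminusPairing
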